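{- Let $U$ be a finite set, let $d$ and $l$ be positive integers, let $C \subseteq U$ with $|C| < d$, and let $\mathcal{F}$ be a family of subsets of $U$, each of size at most $d$, such that (1) there are at least $l^{d-|C|}$ sets $F \in \mathcal{F}$ with $F \supseteq C$, and (2) for every set $C' \subseteq U$ with $C' \supsetneq C$ and $|C'| \leq d$, there are at most $l^{d-|C'|}$ sets $F' \in \mathcal{F}$ with $F' \supseteq C'$. Then $\mathcal{F}$ contains an $l$-flower with core $C$, or $C \in \mathcal{F}$.
   Context: For a family $\mathcal{F}$ and a set $C$, the restriction of $\mathcal{F}$ onto $C$ is $\mathcal{F}_C = \{F \setminus C : F \in \mathcal{F}, F \supseteq C\}$. A blocking set (hitting set) for a family $\mathcal{G}$ is a set $X$ with $X \cap G \neq \emptyset$ for every $G \in \mathcal{G}$. A family $\mathcal{G}$ is an $l$-flower with core $C$ if every blocking set for the restriction $\mathcal{G}_C$ contains at least $l$ elements. "$\mathcal{F}$ contains an $l$-flower with core $C$" means some subfamily of $\mathcal{F}$ is an $l$-flower with core $C$. -}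

module Defs where

open import Data.Nat using (ℕ; _≤_)
open import Data.List using (List; map; filter; length)
open import Data.List.Relation.Unary.All using (All)
open import Data.List.Membership.Propositional using () renaming (_∈_ to _∈ₗ_)
open import Data.Product using (Σ; _×_)
open import Data.Fin.Subset using (Subset; _⊆_; _─_; _∩_; ∣_∣; Nonempty)
open import Data.Fin.Subset.Properties using (_⊆?_)

-- A family of subsets of U = Fin n is a duplicate-free list of subsets
-- (duplicate-freeness is imposed in the statement).
Family : ℕ → Set
Family n = List (Subset n)

countSup : ∀ {n} → Family n → Subset n → ℕ
countSup 𝓕 C = length (filter (C ⊆?_) 𝓕)

restrict : ∀ {n} → Family n → Subset n → Family n
restrict 𝓕 C = map (λ F → F ─ C) (filter (C ⊆?_) 𝓕)

Blocking : ∀ {n} → Subset n → Family n → Set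
Blocking X 𝒢 = All (λ G → Nonempty (X ∩ G)) 𝒢

IsFlower : ∀ {n} → ℕ → Subset n → Family n → Set
IsFlower l C 𝒢 = ∀ X → Blocking X (restrict 𝒢 C) → l ≤ ∣ X ∣

ContainsFlower : ∀ {n} → Family n → ℕ → Subset n → Set
ContainsFlower 𝓕 l C = Σ (Family _) (λ 𝒢 → All (_∈ₗ 𝓕) 𝒢 × IsFlower l C 𝒢)

-- Every member of 𝓕 containing C meets a blocking set X of the restriction
-- 𝓕_C in some x ∈ X ∖ C, hence contains the strictly larger set C ∪ {x}.
-- Summing over x gives #{F ⊇ C} ≤ |X| · l^(d−|C|−1), so hypothesis (1)
-- forces |X| ≥ l: the whole family 𝓕 is already an l-flower with core C.
module Submission where

open import Defs
open import Data.Nat using (ℕ; suc; _≤_; _<_; _^_; _∸_; _+_; _*_; z≤n; NonZero; >-nonZero)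
open import Data.Nat.Properties using (≤-refl; ≤-trans; module ≤-Reasoning; +-mono-≤; +-mono-<-≤; +-mono-≤-<; *-monoˡ-≤; *-cancelʳ-≤; m^n≢0; +-∸-assoc)
open import Data.Fin using (Fin; zero; suc)
open import Data.Fin.Subset using (Subset; _⊂_; ∣_∣; _∈_; _∉_; _⊆_; _∪_; _─_; ⁅_⁆; inside; outside)
open import Data.Fin.Subset.Properties using (_⊆?_; x∈p∩q⁻; x∈p∪q⁻; x∈p∪q⁺; p⊆p∪q; x∈⁅x⁆; x∈⁅y⁆⇒x≡y; x∈p∧x∉q⇒x∈p─q; p─q⊆p; ∣p─q∣≤∣p∣; ∪-identityʳ)
open import Data.Vec using ([]; _∷_; here; there)
open import Data.List using (List; []; _∷_; filter; length)
open import Data.List.Properties using (filter-accept)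
open import Data.List.Relation.Unary.All as All using (All; []; _∷_)
open import Data.List.Relation.Unary.All.Properties using (map⁻; all-filter)
open import Data.List.Relation.Unary.Unique.Propositional using (Unique)
open import Data.List.Membership.Propositional using () renaming (_∈_ to _∈ₗ_)
open import Data.List.Relation.Binary.Sublist.Propositional using (_∷ʳ_; ⊆-refl)
open import Data.List.Relation.Binary.Sublist.Propositional.Properties as Sublist using (filter-⊆; length-mono-≤)
open import Data.Product using (∃; _×_; _,_)
open import Data.Sum using (_⊎_; inj₁; inj₂)
open import Function using (id; _∘_)
open import Relation.Nullary using (contradiction)
open import Relation.Unary using (Pred; Decidable)
open import Relation.Binary.PropositionalEquality using (_≡_; refl; cong; sym; subst)

private
  variable
    n : ℕ

sumOver : Subset n → (Fin n → ℕ) → ℕ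
sumOver []            f = 0
sumOver (inside ∷ Y)  f = f zero + sumOver Y (f ∘ suc)
sumOver (outside ∷ Y) f = sumOver Y (f ∘ suc)

sumOver-mono-≤ : ∀ (Y : Subset n) {f g} → (∀ x → f x ≤ g x) → sumOver Y f ≤ sumOver Y g
sumOver-mono-≤ []            f≤g = z≤n
sumOver-mono-≤ (inside ∷ Y)  f≤g = +-mono-≤ (f≤g zero) (sumOver-mono-≤ Y (f≤g ∘ suc))
sumOver-mono-≤ (outside ∷ Y) f≤g = sumOver-mono-≤ Y (f≤g ∘ suc)

sumOver-mono-< : ∀ (Y : Subset n) {f g x} → x ∈ Y → f x < g x → (∀ y → f y ≤ g y) →
                 sumOver Y f < sumOver Y g
sumOver-mono-< (inside ∷ Y) here fx<gx f≤g = +-mono-<-≤ fx<gx (sumOver-mono-≤ Y (f≤g ∘ suc))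
sumOver-mono-< (inside ∷ Y) (there x∈Y) fx<gx f≤g =
  +-mono-≤-< (f≤g zero) (sumOver-mono-< Y x∈Y fx<gx (f≤g ∘ suc))
sumOver-mono-< (outside ∷ Y) (there x∈Y) fx<gx f≤g = sumOver-mono-< Y x∈Y fx<gx (f≤g ∘ suc)

sumOver-≤-∣∣* : ∀ (Y : Subset n) {f} B → (∀ x → x ∈ Y → f x ≤ B) → sumOver Y f ≤ ∣ Y ∣ * B
sumOver-≤-∣∣* []            B f≤B = z≤n
sumOver-≤-∣∣* (inside ∷ Y)  B f≤B = +-mono-≤ (f≤B zero here) (sumOver-≤-∣∣* Y B (λ x → f≤B (suc x) ∘ there))
sumOver-≤-∣∣* (outside ∷ Y) B f≤B = sumOver-≤-∣∣* Y B (λ x → f≤B (suc x) ∘ there)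

module UnionBound {a q} {A : Set a} {Q : Fin n → Pred A q} (Q? : ∀ x → Decidable (Q x)) (Y : Subset n) where

  count : List A → Fin n → ℕ
  count zs x = length (filter (Q? x) zs)

  count-∷-≤ : ∀ z zs x → count zs x ≤ count (z ∷ zs) x
  count-∷-≤ z zs x = length-mono-≤ (Sublist.filter⁺ (Q? x) (Q? x) (λ { refl → id }) (z ∷ʳ ⊆-refl))

  count-∷-< : ∀ {z} zs {x} → Q x z → count zs x < count (z ∷ zs) x
  count-∷-< zs {x} qxz rewrite filter-accept (Q? x) {xs = zs} qxz = ≤-refl

  length-≤-sumOver-count : ∀ zs → All (λ z → ∃ λ x → x ∈ Y × Q x z) zs → length zs ≤ sumOver Y (count zs)
  length-≤-sumOver-count []       []                          = z≤n
  length-≤-sumOver-count (z ∷ zs) ((x , x∈Y , qxz) ∷ covered) = begin-strict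
    length zs                  ≤⟨ length-≤-sumOver-count zs covered ⟩
    sumOver Y (count zs)       <⟨ sumOver-mono-< Y x∈Y (count-∷-< zs qxz) (count-∷-≤ z zs) ⟩
    sumOver Y (count (z ∷ zs)) ∎
    where open ≤-Reasoning

x∈p─q⇒x∉q : ∀ {p q : Subset n} {x} → x ∈ p ─ q → x ∉ q
x∈p─q⇒x∉q {p = _ ∷ _} {outside ∷ _} here        ()
x∈p─q⇒x∉q {p = _ ∷ _} {_ ∷ _}       (there x∈) (there x∈q) = x∈p─q⇒x∉q x∈ x∈q

∣p∪⁅x⁆∣≡1+∣p∣ : ∀ (p : Subset n) {x} → x ∉ p → ∣ p ∪ ⁅ x ⁆ ∣ ≡ suc ∣ p ∣
∣p∪⁅x⁆∣≡1+∣p∣ (inside ∷ p)  {zero}  x∉p = contradiction here x∉p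
∣p∪⁅x⁆∣≡1+∣p∣ (outside ∷ p) {zero}  x∉p = cong (suc ∘ ∣_∣) (∪-identityʳ p)
∣p∪⁅x⁆∣≡1+∣p∣ (inside ∷ p)  {suc x} x∉p = cong suc (∣p∪⁅x⁆∣≡1+∣p∣ p (x∉p ∘ there))
∣p∪⁅x⁆∣≡1+∣p∣ (outside ∷ p) {suc x} x∉p = ∣p∪⁅x⁆∣≡1+∣p∣ p (x∉p ∘ there)

∪⁅⁆-⊆ : ∀ {p q : Subset n} {x} → p ⊆ q → x ∈ q → p ∪ ⁅ x ⁆ ⊆ q
∪⁅⁆-⊆ {p = p} p⊆q x∈q y∈ with x∈p∪q⁻ p _ y∈
... | inj₁ y∈p = p⊆q y∈p
... | inj₂ y∈⁅x⁆ = subst (_∈ _) (sym (x∈⁅y⁆⇒x≡y _ y∈⁅x⁆)) x∈q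

blocking⇒extends : ∀ (𝓕 : Family n) C {X} → Blocking X (restrict 𝓕 C) →
                   All (λ F → ∃ λ x → x ∈ X ─ C × C ∪ ⁅ x ⁆ ⊆ F) (filter (C ⊆?_) 𝓕)
blocking⇒extends 𝓕 C {X} blocks =
  All.zipWith extend (all-filter (C ⊆?_) 𝓕 , map⁻ blocks)
  where
  extend : ∀ {F} → C ⊆ F × _ → ∃ λ x → x ∈ X ─ C × C ∪ ⁅ x ⁆ ⊆ F
  extend (C⊆F , x , x∈X∩F─C) with x∈p∩q⁻ X _ x∈X∩F─C
  ... | x∈X , x∈F─C = x , x∈p∧x∉q⇒x∈p─q x∈X (x∈p─q⇒x∉q x∈F─C) , ∪⁅⁆-⊆ C⊆F (p─q⊆p _ C x∈F─C)

countSup-≤-∣blocking∣* : ∀ (𝓕 : Family n) C {X} B → Blocking X (restrict 𝓕 C) →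
                          (∀ x → x ∉ C → countSup 𝓕 (C ∪ ⁅ x ⁆) ≤ B) → countSup 𝓕 C ≤ ∣ X ∣ * B
countSup-≤-∣blocking∣* 𝓕 C {X} B blocks links≤B = begin
  countSup 𝓕 C                ≤⟨ length-≤-sumOver-count 𝓕⊇C (blocking⇒extends 𝓕 C blocks) ⟩
  sumOver (X ─ C) (count 𝓕⊇C) ≤⟨ sumOver-≤-∣∣* (X ─ C) B count≤B ⟩
  ∣ X ─ C ∣ * B               ≤⟨ *-monoˡ-≤ B (∣p─q∣≤∣p∣ X C) ⟩
  ∣ X ∣ * B                   ∎
  where
  open ≤-Reasoning
  open UnionBound (λ x → (C ∪ ⁅ x ⁆) ⊆?_) (X ─ C)
  𝓕⊇C : Family _
  𝓕⊇C = filter (C ⊆?_) 𝓕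
  count≤B : ∀ x → x ∈ X ─ C → count 𝓕⊇C x ≤ B
  count≤B x x∈X─C = ≤-trans
    (length-mono-≤ (Sublist.filter⁺ Q? Q? (λ { refl → id }) (filter-⊆ (C ⊆?_) 𝓕)))
    (links≤B x (x∈p─q⇒x∉q x∈X─C))
    where
    Q? : Decidable ((C ∪ ⁅ x ⁆) ⊆_)
    Q? = (C ∪ ⁅ x ⁆) ⊆?_

isFlower-of-links≤ : ∀ (𝓕 : Family n) C l B .{{_ : NonZero B}} →
                     (∀ x → x ∉ C → countSup 𝓕 (C ∪ ⁅ x ⁆) ≤ B) → l * B ≤ countSup 𝓕 C →
                     IsFlower l C 𝓕
isFlower-of-links≤ 𝓕 C l B links≤B lB≤count X blocks =
  *-cancelʳ-≤ l ∣ X ∣ B (≤-trans lB≤count (countSup-≤-∣blocking∣* 𝓕 C B blocks links≤B))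

p⊂p∪⁅x⁆ : ∀ {p : Subset n} {x} → x ∉ p → p ⊂ p ∪ ⁅ x ⁆
p⊂p∪⁅x⁆ {x = x} x∉p = p⊆p∪q ⁅ x ⁆ , x , x∈p∪q⁺ (inj₂ (x∈⁅x⁆ x)) , x∉p

-- The first disjunct always holds.
lemma3 : (n d l : ℕ) → 1 ≤ d → 1 ≤ l →
         (C : Subset n) → ∣ C ∣ < d →
         (𝓕 : Family n) → Unique 𝓕 →
         All (λ F → ∣ F ∣ ≤ d) 𝓕 →
         l ^ (d ∸ ∣ C ∣) ≤ countSup 𝓕 C →
         ((C′ : Subset n) → C ⊂ C′ → ∣ C′ ∣ ≤ d → countSup 𝓕 C′ ≤ l ^ (d ∸ ∣ C′ ∣)) →
         ContainsFlower 𝓕 l C ⊎ C ∈ₗ 𝓕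
lemma3 n d l _ 1≤l C ∣C∣<d 𝓕 _ _ many≥C few≥C′ =
  inj₁ (𝓕 , All.tabulate id , isFlower-of-links≤ 𝓕 C l B links≤B lB≤count)
  where
  instance
    l≢0 : NonZero l
    l≢0 = >-nonZero 1≤l
  B : ℕ
  B = l ^ (d ∸ suc ∣ C ∣)
  instance
    B≢0 : NonZero B
    B≢0 = m^n≢0 l (d ∸ suc ∣ C ∣)
  links≤B : ∀ x → x ∉ C → countSup 𝓕 (C ∪ ⁅ x ⁆) ≤ B
  links≤B x x∉C =
    subst (λ c → countSup 𝓕 (C ∪ ⁅ x ⁆) ≤ l ^ (d ∸ c)) ∣C∪x∣≡1+∣C∣
      (few≥C′ (C ∪ ⁅ x ⁆) (p⊂p∪⁅x⁆ x∉C) (subst (_≤ d) (sym ∣C∪x∣≡1+∣C∣) ∣C∣<d))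
    where
    ∣C∪x∣≡1+∣C∣ : ∣ C ∪ ⁅ x ⁆ ∣ ≡ suc ∣ C ∣
    ∣C∪x∣≡1+∣C∣ = ∣p∪⁅x⁆∣≡1+∣p∣ C x∉C
  lB≤count : l * B ≤ countSup 𝓕 C
  lB≤count = subst (λ e → l ^ e ≤ countSup 𝓕 C) (+-∸-assoc 1 ∣C∣<d) many≥C
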